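{- Let $\mathbf R=(R,\oplus,\cdot,0,1)$ be a ring-like structure of events (RLSE) which admits a full set $S$ of states. For $x\in R$ define $q_x:S\to[0,1]$ by $q_x(m):=m(x)$. Then $\mathbf R$ is order-isomorphic (via $x\mapsto q_x$) to the set $P:=\{q_x\mid x\in R\}$ of $S$-probabilities ordered pointwise, and $P$ is a lattice-ordered algebra of $S$-probabilities.
   Context: A ring-like structure of events (RLSE) is an algebra $(R,\oplus,\cdot,0,1)$ of type $(2,2,0,0)$ such that $(R,\cdot,1)$ is an idempotent commutative monoid with zero element $0$ (i.e. $x0=0$), satisfying (R1) $x\oplus y= y\oplus x$; (R2) $(xy\oplus1)(x\oplus1)\oplus1= x$; (R3) $((xy\oplus1)x\oplus1)x= xy$; (R4) $xy\oplus(x\oplus1)=(xy\oplus1)x\oplus1$. It is partially ordered by $x\le y$ iff $xy=x$, and $x\perp y$ means $x\le x\oplus 1$ replaced by $x\le y\oplus1$. A state on $\mathbf R$ is a map $m:R\to[0,1]$ with $m(1)=1$ and $m(x\oplus y)=m(x)+m(y)$ whenever $x\perp y$. A set $S$ of states is full if for all $x,y\in R$: $x\le y$ iff $m(x)\le m(y)$ for all $m\in S$. An $S$-probability is a function $S\to[0,1]$; with $p':=1-p$ and $p\perp q$ meaning $p\le q'$ pointwise, an algebra of $S$-probabilities is a set $P$ of $S$-probabilities containing the constants $0,1$, closed under $p\mapsto p'$, and such that $p+q+r\in P$ whenever $p,q,r\in P$ are pairwise orthogonal; it is lattice-ordered if it is a lattice under the pointwise order. -}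

module Defs where

open import Level using (0ℓ)
open import Data.Product using (Σ; ∃; _×_; _,_)
open import Relation.Binary.PropositionalEquality using (_≡_; _≢_)
open import Relation.Binary.Structures using (IsTotalOrder)
open import Algebra.Structures using (IsCommutativeRing)
open import Function.Bundles using (_⇔_)

-- The real numbers, axiomatised as a Dedekind-complete ordered field.
-- (agda-stdlib has no reals; any such structure is isomorphic to ℝ,
-- and the theorem is quantified over all of them.)

record CompleteOrderedField : Set₁ where
  infixl 6 _+_
  infixl 7 _*_
  infix  4 _≤_
  field
    ℝ     : Set
    _+_   : ℝ → ℝ → ℝ
    _*_   : ℝ → ℝ → ℝ
    -_    : ℝ → ℝ
    0ℝ    : ℝ
    1ℝ    : ℝ
    _≤_   : ℝ → ℝ → Set
    isCommutativeRing : IsCommutativeRing _≡_ _+_ _*_ -_ 0ℝ 1ℝ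
    0≢1   : 0ℝ ≢ 1ℝ
    inverse : ∀ x → x ≢ 0ℝ → ∃ λ y → x * y ≡ 1ℝ
    isTotalOrder : IsTotalOrder _≡_ _≤_
    +-mono : ∀ x y z → x ≤ y → x + z ≤ y + z
    *-pos  : ∀ x y → 0ℝ ≤ x → 0ℝ ≤ y → 0ℝ ≤ x * y
    complete : (A : ℝ → Set) → (∃ λ a → A a) →
               (∃ λ b → ∀ a → A a → a ≤ b) →
               ∃ λ s → (∀ a → A a → a ≤ s) ×
                       (∀ b → (∀ a → A a → a ≤ b) → s ≤ b)

record RLSE : Set₁ where
  infixl 6 _⊕_
  infixl 7 _·_
  field
    R   : Set
    _⊕_ : R → R → R
    _·_ : R → R → R
    𝟘   : R
    𝟙   : R
    ·-assoc : ∀ x y z → (x · y) · z ≡ x · (y · z)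
    ·-comm  : ∀ x y → x · y ≡ y · x
    ·-idem  : ∀ x → x · x ≡ x
    ·-idʳ   : ∀ x → x · 𝟙 ≡ x
    ·-zeroʳ : ∀ x → x · 𝟘 ≡ 𝟘
    R1 : ∀ x y → x ⊕ y ≡ y ⊕ x
    R2 : ∀ x y → (x · y ⊕ 𝟙) · (x ⊕ 𝟙) ⊕ 𝟙 ≡ x
    R3 : ∀ x y → ((x · y ⊕ 𝟙) · x ⊕ 𝟙) · x ≡ x · y
    R4 : ∀ x y → x · y ⊕ (x ⊕ 𝟙) ≡ (x · y ⊕ 𝟙) · x ⊕ 𝟙

  _≤ᴿ_ : R → R → Set
  x ≤ᴿ y = x · y ≡ x

  _⊥_ : R → R → Set
  x ⊥ y = x ≤ᴿ (y ⊕ 𝟙)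

module _ (F : CompleteOrderedField) (𝐑 : RLSE) where
  open CompleteOrderedField F
  open RLSE 𝐑

  IsState : (R → ℝ) → Set
  IsState m = (∀ x → (0ℝ ≤ m x) × (m x ≤ 1ℝ))
            × (m 𝟙 ≡ 1ℝ)
            × (∀ x y → x ⊥ y → m (x ⊕ y) ≡ m x + m y)

  -- a family of states (the set S is given as an index type S with st)
  -- is full
  IsFull : (S : Set) → (S → R → ℝ) → Set
  IsFull S st = ∀ x y → (x ≤ᴿ y) ⇔ (∀ s → st s x ≤ st s y)

module _ (F : CompleteOrderedField) (S : Set) where
  open CompleteOrderedField F

  SProbFun : Set
  SProbFun = S → ℝ

  IsSProb : SProbFun → Set
  IsSProb p = ∀ s → (0ℝ ≤ p s) × (p s ≤ 1ℝ)

  _≤ₚ_ : SProbFun → SProbFun → Set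
  p ≤ₚ q = ∀ s → p s ≤ q s

  _≈ₚ_ : SProbFun → SProbFun → Set
  p ≈ₚ q = ∀ s → p s ≡ q s

  _′ : SProbFun → SProbFun
  (p ′) s = 1ℝ + (- p s)

  _⊥ₚ_ : SProbFun → SProbFun → Set
  p ⊥ₚ q = p ≤ₚ (q ′)

  const : ℝ → SProbFun
  const r _ = r

  -- membership in P is taken up to pointwise equality (P is a set of
  -- functions; without function extensionality we use ≈ₚ).
  -- An algebra of S-probabilities, P given as a predicate.
  IsAlgebraOfSProb : (SProbFun → Set) → Set
  IsAlgebraOfSProb P =
      (∀ p → P p → IsSProb p)
    × (∀ p q → p ≈ₚ q → P p → P q)
    × P (const 0ℝ)
    × P (const 1ℝ)
    × (∀ p → P p → P (p ′))
    × (∀ p q r → P p → P q → P r →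
         p ⊥ₚ q → p ⊥ₚ r → q ⊥ₚ r → P (λ s → p s + q s + r s))

  IsLatticeOrdered : (SProbFun → Set) → Set
  IsLatticeOrdered P =
    ∀ p q → P p → P q →
      (∃ λ j → P j × p ≤ₚ j × q ≤ₚ j ×
         (∀ u → P u → p ≤ₚ u → q ≤ₚ u → j ≤ₚ u))
    × (∃ λ k → P k × k ≤ₚ p × k ≤ₚ q ×
         (∀ u → P u → u ≤ₚ p → u ≤ₚ q → u ≤ₚ k))

-- Fullness makes x ↦ q x an order embedding, so every order-theoretic fact
-- about ℝ-valued states transfers back to 𝐑.  Since every state satisfies
-- m (x ⊕ 1) = 1 - m x, the complement x ᶜ := x ⊕ 1 is an antitone
-- involution of 𝐑; hence 𝐑, which is a meet-semilattice under ·, is a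
-- lattice with x ∨ y = (x ᶜ · y ᶜ) ᶜ, and for orthogonal x, y the axiom R4
-- identifies x ⊕ y with x ∨ y.  This makes pairwise orthogonal triples sum
-- to an element of 𝐑, and transporting along q gives the algebra and
-- lattice structure of P.
module Submission where

open import Defs
open import Data.Product using (∃; _×_; _,_; proj₁; proj₂)
open import Relation.Binary.PropositionalEquality
  using (_≡_; refl; sym; trans; cong; cong₂; subst; subst₂; module ≡-Reasoning)
open import Function.Bundles using (_⇔_; mk⇔; Equivalence)
open import Algebra.Bundles using (CommutativeRing)
open import Relation.Binary.Structures using (IsTotalOrder)
import Algebra.Properties.Ring as RingProperties
import Algebra.Properties.CommutativeSemigroup as CommutativeSemigroupProperties

module OrderedFieldProperties (F : CompleteOrderedField) where
  open CompleteOrderedField F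

  commutativeRing : CommutativeRing _ _
  commutativeRing = record { isCommutativeRing = isCommutativeRing }

  open CommutativeRing commutativeRing using (ring; +-assoc; +-commutativeSemigroup)
  open RingProperties ring public using (+-identityʳ-unique; x≈z//y)
  open RingProperties ring using (xyx⁻¹≈y)
  open CommutativeSemigroupProperties +-commutativeSemigroup using (xy∙z≈xz∙y)

  ≤-reflexive : ∀ {a b} → a ≡ b → a ≤ b
  ≤-reflexive = IsTotalOrder.reflexive isTotalOrder

  x+[y-x]≡y : ∀ x y → x + (y + - x) ≡ y
  x+[y-x]≡y x y = trans (sym (+-assoc x y (- x))) (xyx⁻¹≈y x y)

  1-‿antitone : ∀ {a b} → a ≤ b → 1ℝ + - b ≤ 1ℝ + - a
  1-‿antitone {a} {b} a≤b = subst₂ _≤_ a+c≡1-b b+c≡1-a (+-mono a b c a≤b)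
    where
    c = 1ℝ + - a + - b
    a+c≡1-b : a + c ≡ 1ℝ + - b
    a+c≡1-b = trans (cong (a +_) (xy∙z≈xz∙y 1ℝ (- a) (- b))) (x+[y-x]≡y a (1ℝ + - b))
    b+c≡1-a : b + c ≡ 1ℝ + - a
    b+c≡1-a = x+[y-x]≡y b (1ℝ + - a)

module RLSEProperties (𝐑 : RLSE) where
  open RLSE 𝐑
  open ≡-Reasoning

  infix 30 _ᶜ
  _ᶜ : R → R
  x ᶜ = x ⊕ 𝟙

  ᶜ-involutive : ∀ x → x ᶜ ᶜ ≡ x
  ᶜ-involutive x = begin
    x ᶜ ᶜ                 ≡⟨ cong _ᶜ (·-idem (x ᶜ)) ⟨
    (x ᶜ · x ᶜ) ᶜ         ≡⟨ cong (λ u → (u ᶜ · x ᶜ) ᶜ) (·-idʳ x) ⟨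
    ((x · 𝟙) ᶜ · x ᶜ) ᶜ   ≡⟨ R2 x 𝟙 ⟩
    x                     ∎

  ᶜ-injective : ∀ {x y} → x ᶜ ≡ y ᶜ → x ≡ y
  ᶜ-injective {x} {y} eq = trans (sym (ᶜ-involutive x)) (trans (cong _ᶜ eq) (ᶜ-involutive y))

  𝟘ᶜ-identityˡ : ∀ y → 𝟘 ᶜ · y ≡ y
  𝟘ᶜ-identityˡ y = begin
    𝟘 ᶜ · y          ≡⟨ cong (𝟘 ᶜ ·_) (ᶜ-involutive y) ⟨
    𝟘 ᶜ · y ᶜ ᶜ      ≡⟨ ᶜ-injective 𝟘ᶜ·yᶜᶜ-ᶜ ⟩
    y ᶜ ᶜ            ≡⟨ ᶜ-involutive y ⟩
    y                ∎
    where
    𝟘ᶜ·yᶜᶜ-ᶜ : (𝟘 ᶜ · y ᶜ ᶜ) ᶜ ≡ y ᶜ ᶜ ᶜ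
    𝟘ᶜ·yᶜᶜ-ᶜ = begin
      (𝟘 ᶜ · y ᶜ ᶜ) ᶜ           ≡⟨ cong (λ u → (u ᶜ · y ᶜ ᶜ) ᶜ) (·-zeroʳ (y ᶜ)) ⟨
      ((y ᶜ · 𝟘) ᶜ · y ᶜ ᶜ) ᶜ   ≡⟨ R2 (y ᶜ) 𝟘 ⟩
      y ᶜ                       ≡⟨ ᶜ-involutive (y ᶜ) ⟨
      y ᶜ ᶜ ᶜ                   ∎

  𝟘ᶜ≡𝟙 : 𝟘 ᶜ ≡ 𝟙
  𝟘ᶜ≡𝟙 = trans (sym (·-idʳ (𝟘 ᶜ))) (𝟘ᶜ-identityˡ 𝟙)

  xᶜ·x≡𝟘 : ∀ x → x ᶜ · x ≡ 𝟘
  xᶜ·x≡𝟘 x = begin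
    x ᶜ · x                 ≡⟨ cong (λ u → u ᶜ · x) (𝟘ᶜ-identityˡ x) ⟨
    (𝟘 ᶜ · x) ᶜ · x         ≡⟨ cong (λ u → (u ᶜ · x) ᶜ · x) (·-zeroʳ x) ⟨
    ((x · 𝟘) ᶜ · x) ᶜ · x   ≡⟨ R3 x 𝟘 ⟩
    x · 𝟘                   ≡⟨ ·-zeroʳ x ⟩
    𝟘                       ∎

  x⊕xᶜ≡𝟙 : ∀ x → x ⊕ x ᶜ ≡ 𝟙
  x⊕xᶜ≡𝟙 x = begin
    x ⊕ x ᶜ                ≡⟨ cong (_⊕ x ᶜ) (·-idʳ x) ⟨
    x · 𝟙 ⊕ x ᶜ            ≡⟨ R4 x 𝟙 ⟩
    ((x · 𝟙) ᶜ · x) ᶜ      ≡⟨ cong (λ u → (u ᶜ · x) ᶜ) (·-idʳ x) ⟩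
    (x ᶜ · x) ᶜ            ≡⟨ cong _ᶜ (xᶜ·x≡𝟘 x) ⟩
    𝟘 ᶜ                    ≡⟨ 𝟘ᶜ≡𝟙 ⟩
    𝟙                      ∎

  xᶜ⊥x : ∀ x → x ᶜ ⊥ x
  xᶜ⊥x x = ·-idem (x ᶜ)

  ≤ᴿ-antisym : ∀ {x y} → x ≤ᴿ y → y ≤ᴿ x → x ≡ y
  ≤ᴿ-antisym {x} {y} x≤y y≤x = trans (sym x≤y) (trans (·-comm x y) y≤x)

  x·y≤x : ∀ x y → (x · y) ≤ᴿ x
  x·y≤x x y = begin
    x · y · x     ≡⟨ ·-assoc x y x ⟩
    x · (y · x)   ≡⟨ cong (x ·_) (·-comm y x) ⟩
    x · (x · y)   ≡⟨ ·-assoc x x y ⟨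
    x · x · y     ≡⟨ cong (_· y) (·-idem x) ⟩
    x · y         ∎

  x·y≤y : ∀ x y → (x · y) ≤ᴿ y
  x·y≤y x y = trans (·-assoc x y y) (cong (x ·_) (·-idem y))

  ·-greatest : ∀ {w x y} → w ≤ᴿ x → w ≤ᴿ y → w ≤ᴿ (x · y)
  ·-greatest {w} {x} {y} w≤x w≤y = trans (sym (·-assoc w x y)) (trans (cong (_· y) w≤x) w≤y)

  infixl 6 _∨_
  _∨_ : R → R → R
  x ∨ y = (x ᶜ · y ᶜ) ᶜ

  ⊥⇒⊕≡∨ : ∀ {x y} → x ⊥ y → x ⊕ y ≡ x ∨ y
  ⊥⇒⊕≡∨ {x} {y} x⊥y = begin
    x ⊕ y                  ≡⟨ cong₂ _⊕_ yᶜ·x≡x (ᶜ-involutive y) ⟨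
    y ᶜ · x ⊕ y ᶜ ᶜ        ≡⟨ R4 (y ᶜ) x ⟩
    ((y ᶜ · x) ᶜ · y ᶜ) ᶜ  ≡⟨ cong (λ u → (u ᶜ · y ᶜ) ᶜ) yᶜ·x≡x ⟩
    x ∨ y                  ∎
    where
    yᶜ·x≡x : y ᶜ · x ≡ x
    yᶜ·x≡x = trans (·-comm (y ᶜ) x) x⊥y

module StateProperties (F : CompleteOrderedField) (𝐑 : RLSE)
    {m : RLSE.R 𝐑 → CompleteOrderedField.ℝ F} (isState : IsState F 𝐑 m) where
  open CompleteOrderedField F
  open RLSE 𝐑
  open OrderedFieldProperties F
  open RLSEProperties 𝐑

  m-bounded : ∀ x → (0ℝ ≤ m x) × (m x ≤ 1ℝ)
  m-bounded = proj₁ isState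

  m-𝟙 : m 𝟙 ≡ 1ℝ
  m-𝟙 = proj₁ (proj₂ isState)

  m-⊕ : ∀ {x y} → x ⊥ y → m (x ⊕ y) ≡ m x + m y
  m-⊕ {x} {y} = proj₂ (proj₂ isState) x y

  m-ᶜ : ∀ x → m (x ᶜ) ≡ 1ℝ + - m x
  m-ᶜ x = x≈z//y (m (x ᶜ)) (m x) 1ℝ (begin
    m (x ᶜ) + m x   ≡⟨ m-⊕ (xᶜ⊥x x) ⟨
    m (x ᶜ ⊕ x)     ≡⟨ cong m (trans (R1 (x ᶜ) x) (x⊕xᶜ≡𝟙 x)) ⟩
    m 𝟙             ≡⟨ m-𝟙 ⟩
    1ℝ              ∎)
    where open ≡-Reasoning

  m-𝟘 : m 𝟘 ≡ 0ℝ
  m-𝟘 = +-identityʳ-unique (m 𝟙) (m 𝟘) (begin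
    m 𝟙 + m 𝟘   ≡⟨ m-⊕ 𝟙⊥𝟘 ⟨
    m (𝟙 ⊕ 𝟘)   ≡⟨ cong m (trans (R1 𝟙 𝟘) 𝟘ᶜ≡𝟙) ⟩
    m 𝟙         ∎)
    where
    open ≡-Reasoning
    𝟙⊥𝟘 : 𝟙 ⊥ 𝟘
    𝟙⊥𝟘 = trans (cong (𝟙 ·_) 𝟘ᶜ≡𝟙) (·-idʳ 𝟙)

module FullSetOfStates (F : CompleteOrderedField) (𝐑 : RLSE)
    (S : Set) (st : S → RLSE.R 𝐑 → CompleteOrderedField.ℝ F)
    (states : ∀ s → IsState F 𝐑 (st s)) (full : IsFull F 𝐑 S st) where
  open CompleteOrderedField F
  open RLSE 𝐑
  open OrderedFieldProperties F
  open RLSEProperties 𝐑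
  module St s = StateProperties F 𝐑 (states s)

  q : R → S → ℝ
  q x s = st s x

  P : (S → ℝ) → Set
  P p = ∃ λ x → _≈ₚ_ F S p (q x)

  ≤ᴿ⇒≤ₚ : ∀ {x y} → x ≤ᴿ y → _≤ₚ_ F S (q x) (q y)
  ≤ᴿ⇒≤ₚ {x} {y} = Equivalence.to (full x y)

  ≤ₚ⇒≤ᴿ : ∀ {x y} → _≤ₚ_ F S (q x) (q y) → x ≤ᴿ y
  ≤ₚ⇒≤ᴿ {x} {y} = Equivalence.from (full x y)

  q-injective : ∀ x y → _≈ₚ_ F S (q x) (q y) → x ≡ y
  q-injective x y qx≈qy =
    ≤ᴿ-antisym (≤ₚ⇒≤ᴿ λ s → ≤-reflexive (qx≈qy s)) (≤ₚ⇒≤ᴿ λ s → ≤-reflexive (sym (qx≈qy s)))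

  q-ᶜ : ∀ x → _≈ₚ_ F S (q (x ᶜ)) (_′ F S (q x))
  q-ᶜ x s = St.m-ᶜ s x

  ᶜ-antitone : ∀ {x y} → x ≤ᴿ y → y ᶜ ≤ᴿ x ᶜ
  ᶜ-antitone {x} {y} x≤y = ≤ₚ⇒≤ᴿ λ s →
    subst₂ _≤_ (sym (q-ᶜ y s)) (sym (q-ᶜ x s)) (1-‿antitone (≤ᴿ⇒≤ₚ x≤y s))

  ⊥-sym : ∀ {x y} → x ⊥ y → y ⊥ x
  ⊥-sym {x} {y} x⊥y = subst (_≤ᴿ x ᶜ) (ᶜ-involutive y) (ᶜ-antitone x⊥y)

  x≤x∨y : ∀ x y → x ≤ᴿ (x ∨ y)
  x≤x∨y x y = subst (_≤ᴿ (x ∨ y)) (ᶜ-involutive x) (ᶜ-antitone (x·y≤x (x ᶜ) (y ᶜ)))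

  y≤x∨y : ∀ x y → y ≤ᴿ (x ∨ y)
  y≤x∨y x y = subst (_≤ᴿ (x ∨ y)) (ᶜ-involutive y) (ᶜ-antitone (x·y≤y (x ᶜ) (y ᶜ)))

  ∨-least : ∀ {w x y} → x ≤ᴿ w → y ≤ᴿ w → (x ∨ y) ≤ᴿ w
  ∨-least {w} x≤w y≤w =
    subst (_ ≤ᴿ_) (ᶜ-involutive w) (ᶜ-antitone (·-greatest (ᶜ-antitone x≤w) (ᶜ-antitone y≤w)))

  ⊕-⊥ : ∀ {x y z} → x ⊥ y → z ⊥ x → z ⊥ y → (x ⊕ y) ⊥ z
  ⊕-⊥ {x} {y} {z} x⊥y z⊥x z⊥y =
    subst (_⊥ z) (sym (⊥⇒⊕≡∨ x⊥y)) (∨-least (⊥-sym z⊥x) (⊥-sym z⊥y))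

  ≤ₚ⇔≤ᴿ : ∀ {p r x y} → _≈ₚ_ F S p (q x) → _≈ₚ_ F S r (q y) →
          _≤ₚ_ F S p r ⇔ x ≤ᴿ y
  ≤ₚ⇔≤ᴿ p≈qx r≈qy = mk⇔
    (λ p≤r → ≤ₚ⇒≤ᴿ λ s → subst₂ _≤_ (p≈qx s) (r≈qy s) (p≤r s))
    (λ x≤y s → subst₂ _≤_ (sym (p≈qx s)) (sym (r≈qy s)) (≤ᴿ⇒≤ₚ x≤y s))

  ⊥ₚ⇒⊥ : ∀ {p r x y} → _≈ₚ_ F S p (q x) → _≈ₚ_ F S r (q y) → _⊥ₚ_ F S p r → x ⊥ y
  ⊥ₚ⇒⊥ {y = y} p≈qx r≈qy p⊥r = Equivalence.to (≤ₚ⇔≤ᴿ p≈qx r′≈qyᶜ) p⊥r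
    where
    r′≈qyᶜ : _≈ₚ_ F S (_′ F S _) (q (y ᶜ))
    r′≈qyᶜ s = trans (cong (λ t → 1ℝ + - t) (r≈qy s)) (sym (q-ᶜ y s))

  P-isAlgebra : IsAlgebraOfSProb F S P
  P-isAlgebra =
      (λ { p (x , p≈qx) s → subst (λ t → (0ℝ ≤ t) × (t ≤ 1ℝ)) (sym (p≈qx s)) (St.m-bounded s x) })
    , (λ { p r p≈r (x , p≈qx) → x , λ s → trans (sym (p≈r s)) (p≈qx s) })
    , (𝟘 , λ s → sym (St.m-𝟘 s))
    , (𝟙 , λ s → sym (St.m-𝟙 s))
    , (λ { p (x , p≈qx) → x ᶜ , λ s → trans (cong (λ t → 1ℝ + - t) (p≈qx s)) (sym (q-ᶜ x s)) })
    , orthogonalSum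
    where
    orthogonalSum : ∀ p r t → P p → P r → P t →
                    _⊥ₚ_ F S p r → _⊥ₚ_ F S p t → _⊥ₚ_ F S r t →
                    P (λ s → p s + r s + t s)
    orthogonalSum p r t (x , p≈qx) (y , r≈qy) (z , t≈qz) p⊥r p⊥t r⊥t = x ⊕ y ⊕ z , λ s →
      begin
        p s + r s + t s          ≡⟨ cong₂ _+_ (cong₂ _+_ (p≈qx s) (r≈qy s)) (t≈qz s) ⟩
        st s x + st s y + st s z ≡⟨ cong (_+ st s z) (St.m-⊕ s x⊥y) ⟨
        st s (x ⊕ y) + st s z    ≡⟨ St.m-⊕ s (⊕-⊥ x⊥y (⊥-sym x⊥z) (⊥-sym y⊥z)) ⟨
        st s (x ⊕ y ⊕ z)         ∎
      where
      open ≡-Reasoning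
      x⊥y = ⊥ₚ⇒⊥ p≈qx r≈qy p⊥r
      x⊥z = ⊥ₚ⇒⊥ p≈qx t≈qz p⊥t
      y⊥z = ⊥ₚ⇒⊥ r≈qy t≈qz r⊥t

  P-isLatticeOrdered : IsLatticeOrdered F S P
  P-isLatticeOrdered p r (x , p≈qx) (y , r≈qy) =
      ( q (x ∨ y) , (x ∨ y , λ _ → refl)
      , from (≤ₚ⇔≤ᴿ p≈qx refl≈) (x≤x∨y x y)
      , from (≤ₚ⇔≤ᴿ r≈qy refl≈) (y≤x∨y x y)
      , λ { u (w , u≈qw) p≤u r≤u → from (≤ₚ⇔≤ᴿ refl≈ u≈qw)
              (∨-least (to (≤ₚ⇔≤ᴿ p≈qx u≈qw) p≤u) (to (≤ₚ⇔≤ᴿ r≈qy u≈qw) r≤u)) })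
    , ( q (x · y) , (x · y , λ _ → refl)
      , from (≤ₚ⇔≤ᴿ refl≈ p≈qx) (x·y≤x x y)
      , from (≤ₚ⇔≤ᴿ refl≈ r≈qy) (x·y≤y x y)
      , λ { u (w , u≈qw) u≤p u≤r → from (≤ₚ⇔≤ᴿ u≈qw refl≈)
              (·-greatest (to (≤ₚ⇔≤ᴿ u≈qw p≈qx) u≤p) (to (≤ₚ⇔≤ᴿ u≈qw r≈qy) u≤r)) })
    where
    open Equivalence
    refl≈ : ∀ {a} → _≈ₚ_ F S (q a) (q a)
    refl≈ _ = refl

theorem2p7 : (F : CompleteOrderedField) (𝐑 : RLSE)
    (S : Set) (st : S → RLSE.R 𝐑 → CompleteOrderedField.ℝ F) →
    (∀ s → IsState F 𝐑 (st s)) → IsFull F 𝐑 S st →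
    let q = λ (x : RLSE.R 𝐑) (s : S) → st s x
        P = λ (p : S → CompleteOrderedField.ℝ F) → ∃ λ x → _≈ₚ_ F S p (q x)
    in (∀ x y → RLSE._≤ᴿ_ 𝐑 x y ⇔ _≤ₚ_ F S (q x) (q y))
       × (∀ x y → _≈ₚ_ F S (q x) (q y) → x ≡ y)
       × IsAlgebraOfSProb F S P
       × IsLatticeOrdered F S P
theorem2p7 F 𝐑 S st states full = full , q-injective , P-isAlgebra , P-isLatticeOrdered
  where open FullSetOfStates F 𝐑 S st states full
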